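{- Let $n \geq 1$. Under optimal play, the Sign Game played on the star graph $S_n$ results in a draw when $n$ is even, and is won by Player 2 (the player who moves second) when $n$ is odd.
   Context: The Sign Game on a simple undirected graph $G$: two players, Player P and Player N, alternate turns; the one moving first is called Player 1, the other Player 2 (either of P, N may be Player 1). On a turn a player assigns $+1$ or $-1$ to a vertex of $G$ not yet assigned. Once both endpoints of an edge have been assigned, the edge takes the value of the product of its endpoint values. The game ends when all vertices are assigned, and the score $s(G)$ is the sum of all edge values. Player P wins if $s(G) > 0$, Player N wins if $s(G) < 0$, and the game is a draw if $s(G) = 0$. Optimal play: each player's primary goal is to win and secondary goal is to force a draw; the result is the outcome under optimal play by both. The star graph $S_n$ has $n+1$ vertices: one central vertex adjacent to each of $n$ leaves, and no other edges. -}

module Defs where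

open import Data.Nat using (ℕ; zero; suc)
open import Data.Integer using (ℤ; +_; -[1+_]; 0ℤ; 1ℤ; _+_; _<_)
open import Data.Integer.Properties using (_<?_)
open import Data.Fin using (Fin)
open import Data.List using (List; []; _∷_; map; foldr; concatMap; allFin)
open import Data.Vec using (Vec; lookup; replicate; _[_]≔_)
open import Data.Maybe using (Maybe; just; nothing)
open import Data.Product using (_×_; _,_)
open import Data.Sign using (Sign) renaming (_*_ to _*ˢ_)
open import Relation.Nullary using (yes; no)

record Graph : Set where
  field
    V     : ℕ
    edges : List (Fin V × Fin V)
open Graph public

-- Star graph S_n: vertex 0 is the centre, vertices 1..n are the leaves.
star : ℕ → Graph
star n = record { V = suc n ; edges = map (λ i → (Fin.zero , Fin.suc i)) (allFin n) }

data Player : Set where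
  P N : Player

other : Player → Player
other P = N
other N = P

-- Outcomes, ordered NWin < Draw < PWin (P wants larger, N wants smaller).
data Outcome : Set where
  NWin Draw PWin : Outcome

winFor : Player → Outcome
winFor P = PWin
winFor N = NWin

max : Outcome → Outcome → Outcome
max PWin _    = PWin
max _    PWin = PWin
max Draw _    = Draw
max _    Draw = Draw
max NWin NWin = NWin

min : Outcome → Outcome → Outcome
min NWin _    = NWin
min _    NWin = NWin
min Draw _    = Draw
min _    Draw = Draw
min PWin PWin = PWin

Assignment : ℕ → Set
Assignment V = Vec (Maybe Sign) V

signℤ : Sign → ℤ
signℤ Sign.+ = 1ℤ
signℤ Sign.- = -[1+ 0 ]

edgeValue : ∀ {V} → Assignment V → Fin V × Fin V → ℤ
edgeValue a (u , v) with lookup a u | lookup a v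
... | just x | just y = signℤ (x *ˢ y)
... | _      | _      = 0ℤ

score : (G : Graph) → Assignment (V G) → ℤ
score G a = foldr (λ e acc → edgeValue a e + acc) 0ℤ (edges G)

outcomeOf : ℤ → Outcome
outcomeOf s with 0ℤ <? s
... | yes _ = PWin
... | no _ with s <? 0ℤ
...   | yes _ = NWin
...   | no _  = Draw

moves : ∀ {V} → Assignment V → List (Fin V × Sign)
moves {V} a = concatMap f (allFin V)
  where
  f : Fin V → List (Fin V × Sign)
  f i with lookup a i
  ... | nothing = (i , Sign.+) ∷ (i , Sign.-) ∷ []
  ... | just _  = []

best : Player → List Outcome → Outcome
best P = foldr max NWin
best N = foldr min PWin

-- The fuel bounds the
-- number of remaining moves; started with fuel = V on the empty assignment,
-- it never runs out before all vertices are assigned.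
value : (G : Graph) → ℕ → Player → Assignment (V G) → Outcome
value G fuel p a with moves a | fuel
... | []         | _      = outcomeOf (score G a)
... | _ ∷ _      | zero   = outcomeOf (score G a)
... | ms@(_ ∷ _) | suc k  =
  best p (map (λ { (i , s) → value G k (other p) (a [ i ]≔ just s) }) ms)

result : (G : Graph) → (first : Player) → Outcome
result G first = value G (V G) first (replicate (V G) nothing)

{-# OPTIONS --safe #-}
-- On a star every edge contains the centre c, so the final score is c times the
-- sum d of the leaf signs.  Once the centre is assigned, the best a player can do
-- on a leaf is to give its edge the sign they prefer, so the remaining u leaves
-- add 0 to the score when u is even and one point for the player to move when u
-- is odd.  While the centre is free, taking it (with the sign that turns d into
-- |d| for the mover) is optimal: after a leaf move to d ± 1 the opponent takes the
-- centre instead, and |d| + |d ± 1| ≥ 1 makes that no better for the mover.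
-- Hence Player 1 takes the centre and the n leaves are then split with Player 2
-- moving first: a draw for even n and a win for Player 2 for odd n.  The proof
-- checks that this closed-form value satisfies the minimax recursion, by
-- induction on the number of unassigned vertices.
module Submission where

open import Defs
open import Data.Nat as ℕ using (ℕ; zero; suc; _≤_; _⊔_; _∸_; z≤n; s≤s)
import Data.Nat.Properties as ℕ
open import Data.Nat.Divisibility using (_∣_; _∣0; ∣-refl; ∣⇒≤; ∣m+n∣m⇒∣n; ∣m∣n⇒∣m+n)
open import Data.Integer
  using (ℤ; +_; -[1+_]; +[1+_]; 0ℤ; 1ℤ; _+_; _-_; _*_; -_; ∣_∣; sign; -≤+; +≤+)
  renaming (_≤_ to _≤ℤ_; _<_ to _<ℤ_)
open import Data.Integer.Properties
  using ( _<?_; <-cmp; <⇒≱; <-asym; ≤-<-trans; ≤-refl; ≤-trans; ≤-reflexive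
        ; +-monoˡ-≤; +-identityˡ; +-identityʳ; *-identityˡ; *-zeroʳ; *-distribˡ-+
        ; -1*i≡-i; neg-≤-pos; ∣i*j∣≡∣i∣*∣j∣; i≤j⇒0≤j-i; 0≤i-j⇒j≤i; +-commutativeSemigroup )
open import Data.Integer.Tactic.RingSolver using (solve-∀)
open import Algebra.Properties.CommutativeSemigroup +-commutativeSemigroup using (x∙yz≈y∙xz)
open import Data.Sign using (Sign) renaming (_*_ to _*ˢ_)
import Data.Sign.Properties as Sign
open import Data.Fin using (Fin)
open import Data.List using (List; []; _∷_; map; foldr; concatMap; allFin; tabulate)
open import Data.List.Properties using (concatMap-cong; foldr-map; map-tabulate)
open import Data.List.Relation.Unary.All as All using (All; []; _∷_)
import Data.List.Relation.Unary.All.Properties as All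
open import Data.List.Relation.Unary.Any using (here; there)
import Data.List.Relation.Unary.Any.Properties as Any
open import Data.List.Membership.Propositional using (_∈_)
open import Data.List.Membership.Propositional.Properties using (∈-map⁺; ∈-concatMap⁺; ∈-concatMap⁻)
open import Data.Vec using (Vec; []; _∷_; lookup; replicate; _[_]≔_)
open import Data.Maybe using (Maybe; just; nothing)
open import Data.Product using (_×_; _,_; ∃; ∃₂)
open import Function using (id; _∘_)
open import Relation.Nullary using (¬_; yes; no; contradiction)
open import Relation.Binary using (tri<; tri≈; tri>)
open import Relation.Binary.PropositionalEquality
open ≡-Reasoning

-- Preferences of the players

utility : Player → Outcome → ℕ
utility P NWin = 0
utility P Draw = 1
utility P PWin = 2
utility N NWin = 2
utility N Draw = 1
utility N PWin = 0

infix 4 _≼[_]_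
_≼[_]_ : Outcome → Player → Outcome → Set
x ≼[ p ] y = utility p x ≤ utility p y

≼-PWin : ∀ o → o ≼[ P ] PWin
≼-PWin NWin = z≤n
≼-PWin Draw = s≤s z≤n
≼-PWin PWin = ℕ.≤-refl

fromUtility : Player → ℕ → Outcome
fromUtility P 0 = NWin
fromUtility P 1 = Draw
fromUtility P _ = PWin
fromUtility N 0 = PWin
fromUtility N 1 = Draw
fromUtility N _ = NWin

fromUtility-utility : ∀ p o → fromUtility p (utility p o) ≡ o
fromUtility-utility P NWin = refl
fromUtility-utility P Draw = refl
fromUtility-utility P PWin = refl
fromUtility-utility N NWin = refl
fromUtility-utility N Draw = refl
fromUtility-utility N PWin = refl

utility-injective : ∀ p {x y} → utility p x ≡ utility p y → x ≡ y
utility-injective p {x} {y} eq = begin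
  x                           ≡⟨ sym (fromUtility-utility p x) ⟩
  fromUtility p (utility p x) ≡⟨ cong (fromUtility p) eq ⟩
  fromUtility p (utility p y) ≡⟨ fromUtility-utility p y ⟩
  y                           ∎

utility-max : ∀ x y → utility P (max x y) ≡ utility P x ⊔ utility P y
utility-max NWin NWin = refl
utility-max NWin Draw = refl
utility-max NWin PWin = refl
utility-max Draw NWin = refl
utility-max Draw Draw = refl
utility-max Draw PWin = refl
utility-max PWin NWin = refl
utility-max PWin Draw = refl
utility-max PWin PWin = refl

utility-min : ∀ x y → utility N (min x y) ≡ utility N x ⊔ utility N y
utility-min NWin NWin = refl
utility-min NWin Draw = refl
utility-min NWin PWin = refl
utility-min Draw NWin = refl
utility-min Draw Draw = refl
utility-min Draw PWin = refl
utility-min PWin NWin = refl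
utility-min PWin Draw = refl
utility-min PWin PWin = refl

utility-best-∷ : ∀ p y ys → utility p (best p (y ∷ ys)) ≡ utility p y ⊔ utility p (best p ys)
utility-best-∷ P y ys = utility-max y (best P ys)
utility-best-∷ N y ys = utility-min y (best N ys)

best-≼ : ∀ p {X} ys → All (_≼[ p ] X) ys → best p ys ≼[ p ] X
best-≼ P [] [] = z≤n
best-≼ N [] [] = z≤n
best-≼ p (y ∷ ys) (y≼X ∷ ys≼X) rewrite utility-best-∷ p y ys =
  ℕ.⊔-lub y≼X (best-≼ p ys ys≼X)

≼-best : ∀ p {y} ys → y ∈ ys → y ≼[ p ] best p ys
≼-best p (y ∷ ys) (here refl) rewrite utility-best-∷ p y ys = ℕ.m≤m⊔n _ _
≼-best p (z ∷ ys) (there y∈ys) rewrite utility-best-∷ p z ys =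
  ℕ.≤-trans (≼-best p ys y∈ys) (ℕ.m≤n⊔m _ _)

best-≡ : ∀ p {X} ys → X ∈ ys → All (_≼[ p ] X) ys → best p ys ≡ X
best-≡ p ys X∈ys ys≼X = utility-injective p (ℕ.≤-antisym (best-≼ p ys ys≼X) (≼-best p ys X∈ys))

infix 4 _⊑[_]_
_⊑[_]_ : ℤ → Player → ℤ → Set
x ⊑[ P ] y = x ≤ℤ y
x ⊑[ N ] y = y ≤ℤ x

⊑-+ʳ : ∀ p {x y} b → x ⊑[ p ] y → x + b ⊑[ p ] y + b
⊑-+ʳ P b = +-monoˡ-≤ b
⊑-+ʳ N b = +-monoˡ-≤ b

outcomeOf-pos : ∀ {z} → 0ℤ <ℤ z → outcomeOf z ≡ PWin
outcomeOf-pos {z} 0<z with 0ℤ <? z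
... | yes _    = refl
... | no 0≮z = contradiction 0<z 0≮z

outcomeOf-neg : ∀ {z} → z <ℤ 0ℤ → outcomeOf z ≡ NWin
outcomeOf-neg {z} z<0 with 0ℤ <? z
... | yes 0<z = contradiction z<0 (<-asym 0<z)
... | no _ with z <? 0ℤ
...   | yes _    = refl
...   | no z≮0 = contradiction z<0 z≮0

outcomeOf-nonpos : ∀ {z} → z ≤ℤ 0ℤ → outcomeOf z ≼[ P ] Draw
outcomeOf-nonpos {z} z≤0 with <-cmp z 0ℤ
... | tri< z<0 _ _ rewrite outcomeOf-neg z<0 = z≤n
... | tri≈ _ refl _ = ℕ.≤-refl
... | tri> _ _ 0<z = contradiction z≤0 (<⇒≱ 0<z)

outcomeOf-mono-≤ : ∀ {x y} → x ≤ℤ y → outcomeOf x ≼[ P ] outcomeOf y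
outcomeOf-mono-≤ {x} {y} x≤y with <-cmp 0ℤ y
... | tri< 0<y _ _ rewrite outcomeOf-pos 0<y = ≼-PWin (outcomeOf x)
... | tri≈ _ refl _ = outcomeOf-nonpos x≤y
... | tri> _ _ y<0 rewrite outcomeOf-neg y<0 | outcomeOf-neg (≤-<-trans x≤y y<0) = ℕ.≤-refl

utility-N : ∀ o → utility N o ≡ 2 ∸ utility P o
utility-N NWin = refl
utility-N Draw = refl
utility-N PWin = refl

outcomeOf-mono : ∀ p {x y} → x ⊑[ p ] y → outcomeOf x ≼[ p ] outcomeOf y
outcomeOf-mono P x≤y = outcomeOf-mono-≤ x≤y
outcomeOf-mono N {x} {y} y≤x rewrite utility-N (outcomeOf x) | utility-N (outcomeOf y) =
  ℕ.∸-monoʳ-≤ 2 (outcomeOf-mono-≤ y≤x)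

-- The minimax recursion

freeMovesAt : ∀ {V} → Fin V → Maybe Sign → List (Fin V × Sign)
freeMovesAt i nothing  = (i , Sign.+) ∷ (i , Sign.-) ∷ []
freeMovesAt i (just _) = []

∈-freeMovesAt⁺ : ∀ {V} {i : Fin V} s → (i , s) ∈ freeMovesAt i nothing
∈-freeMovesAt⁺ Sign.+ = here refl
∈-freeMovesAt⁺ Sign.- = there (here refl)

∈-freeMovesAt⁻ : ∀ {V} {i j : Fin V} {s m} → (i , s) ∈ freeMovesAt j m → i ≡ j × m ≡ nothing
∈-freeMovesAt⁻ {m = nothing} (here refl)         = refl , refl
∈-freeMovesAt⁻ {m = nothing} (there (here refl)) = refl , refl

concatMap-on-values : ∀ {V} {X : Set} {K : (Fin V → Maybe Sign) → Fin V → List X}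
  (F : Fin V → Maybe Sign → List X) →
  (∀ f i → K f i ≡ K (λ _ → f i) i) → (∀ i m → K (λ _ → m) i ≡ F i m) →
  ∀ f → concatMap (K f) (allFin V) ≡ concatMap (λ i → F i (f i)) (allFin V)
concatMap-on-values F local values f =
  concatMap-cong (λ i → trans (local f i) (values i (f i))) (allFin _)

-- `moves` splits on `lookup a i` in an anonymous where-clause, which cannot be
-- named.  Abstracting over `lookup a` exposes it as a function K of the looked-up
-- values, inferred from the goal; the hypotheses on K then hold by computation.
moves-lookup : ∀ {V} (a : Assignment V) →
  moves a ≡ concatMap (λ i → freeMovesAt i (lookup a i)) (allFin V)
moves-lookup a
  with concatMap-on-values freeMovesAt (λ _ _ → refl) (λ { _ nothing → refl ; _ (just _) → refl })
     | lookup a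
... | on-values | f = on-values f

∈-moves⁺ : ∀ {V} (a : Assignment V) {i} s → lookup a i ≡ nothing → (i , s) ∈ moves a
∈-moves⁺ a {i} s free = subst ((i , s) ∈_) (sym (moves-lookup a))
  (∈-concatMap⁺ _ (Any.tabulate⁺ i
    (subst (λ m → (i , s) ∈ freeMovesAt i m) (sym free) (∈-freeMovesAt⁺ s))))

∈-moves⁻ : ∀ {V} (a : Assignment V) {i s} → (i , s) ∈ moves a → lookup a i ≡ nothing
∈-moves⁻ a i,s∈moves with Any.tabulate⁻ (∈-concatMap⁻ _ (subst (_ ∈_) (moves-lookup a) i,s∈moves))
... | j , i,s∈j with ∈-freeMovesAt⁻ {j = j} i,s∈j
...   | refl , free = free

value-zero : ∀ G p a → value G 0 p a ≡ outcomeOf (score G a)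
value-zero G p a with moves a
... | []    = refl
... | _ ∷ _ = refl

value-suc : ∀ G k p (a : Assignment (V G)) {X} →
  (∃₂ λ i s → lookup a i ≡ nothing × value G k (other p) (a [ i ]≔ just s) ≡ X) →
  (∀ i s → lookup a i ≡ nothing → value G k (other p) (a [ i ]≔ just s) ≼[ p ] X) →
  value G (suc k) p a ≡ X
value-suc G k p a (i , s , free , attained) bounded with moves a | ∈-moves⁺ a s free | ∈-moves⁻ a
... | m ∷ ms | i,s∈ms | legal = best-≡ p _
  (subst (_∈ _) attained (∈-map⁺ _ i,s∈ms))
  (All.map⁺ (All.tabulate λ { {j , t} j,t∈ms → bounded j t (legal j,t∈ms) }))

-- Partial sign assignments

unassigned : ∀ {A : Set} {m} → Vec (Maybe A) m → ℕ
unassigned []            = 0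
unassigned (nothing ∷ a) = suc (unassigned a)
unassigned (just _ ∷ a)  = unassigned a

unassigned-[]≔ : ∀ {A : Set} {m} (a : Vec (Maybe A) m) {i} x →
  lookup a i ≡ nothing → unassigned a ≡ suc (unassigned (a [ i ]≔ just x))
unassigned-[]≔ (nothing ∷ a) {Fin.zero}  x _    = refl
unassigned-[]≔ (just _ ∷ a)  {Fin.zero}  x ()
unassigned-[]≔ (nothing ∷ a) {Fin.suc i} x free = cong suc (unassigned-[]≔ a x free)
unassigned-[]≔ (just _ ∷ a)  {Fin.suc i} x free = unassigned-[]≔ a x free

unassigned⇒free : ∀ {A : Set} {m} (a : Vec (Maybe A) m) {u} →
  unassigned a ≡ suc u → ∃ λ i → lookup a i ≡ nothing
unassigned⇒free (nothing ∷ a) _  = Fin.zero , refl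
unassigned⇒free (just _ ∷ a)  eq with unassigned⇒free a eq
... | i , free = Fin.suc i , free

unassigned-replicate : ∀ {A : Set} m → unassigned (replicate {A = Maybe A} m nothing) ≡ m
unassigned-replicate zero    = refl
unassigned-replicate (suc m) = cong suc (unassigned-replicate m)

signValue : Maybe Sign → ℤ
signValue nothing  = 0ℤ
signValue (just s) = signℤ s

signSum : ∀ {m} → Vec (Maybe Sign) m → ℤ
signSum []      = 0ℤ
signSum (x ∷ a) = signValue x + signSum a

signSum-[]≔ : ∀ {m} (a : Vec (Maybe Sign) m) {i} s →
  lookup a i ≡ nothing → signSum (a [ i ]≔ just s) ≡ signℤ s + signSum a
signSum-[]≔ (nothing ∷ a) {Fin.zero}  s _    = cong (_+_ (signℤ s)) (sym (+-identityˡ (signSum a)))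
signSum-[]≔ (just _ ∷ a)  {Fin.zero}  s ()
signSum-[]≔ (x ∷ a)       {Fin.suc i} s free = begin
  signValue x + signSum (a [ i ]≔ just s) ≡⟨ cong (_+_ (signValue x)) (signSum-[]≔ a s free) ⟩
  signValue x + (signℤ s + signSum a)     ≡⟨ x∙yz≈y∙xz (signValue x) (signℤ s) (signSum a) ⟩
  signℤ s + (signValue x + signSum a)     ∎

signSum-replicate : ∀ m → signSum (replicate m nothing) ≡ 0ℤ
signSum-replicate zero    = refl
signSum-replicate (suc m) = trans (+-identityˡ _) (signSum-replicate m)

sumFin : ∀ {m} → (Fin m → ℤ) → ℤ
sumFin f = foldr (λ i acc → f i + acc) 0ℤ (allFin _)

sumFin-suc : ∀ {m} (f : Fin (suc m) → ℤ) → sumFin f ≡ f Fin.zero + sumFin (f ∘ Fin.suc)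
sumFin-suc {m} f = cong (_+_ (f Fin.zero)) (begin
  foldr step 0ℤ (tabulate Fin.suc)       ≡⟨ cong (foldr step 0ℤ) (sym (map-tabulate id Fin.suc)) ⟩
  foldr step 0ℤ (map Fin.suc (allFin m)) ≡⟨ foldr-map step Fin.suc 0ℤ (allFin m) ⟩
  sumFin (f ∘ Fin.suc)                   ∎)
  where
  step : Fin (suc m) → ℤ → ℤ
  step i acc = f i + acc

signSum-lookup : ∀ {m} (a : Vec (Maybe Sign) m) → sumFin (signValue ∘ lookup a) ≡ signSum a
signSum-lookup []      = refl
signSum-lookup (x ∷ a) =
  trans (sumFin-suc (signValue ∘ lookup (x ∷ a))) (cong (_+_ (signValue x)) (signSum-lookup a))

-- The star

signℤ-* : ∀ s t → signℤ (s *ˢ t) ≡ signℤ s * signℤ t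
signℤ-* Sign.+ Sign.+ = refl
signℤ-* Sign.+ Sign.- = refl
signℤ-* Sign.- Sign.+ = refl
signℤ-* Sign.- Sign.- = refl

edgeValue-centre : ∀ {n} c (l : Vec (Maybe Sign) n) i →
  edgeValue (just c ∷ l) (Fin.zero , Fin.suc i) ≡ signℤ c * signValue (lookup l i)
edgeValue-centre c l i with lookup l i
... | nothing = sym (*-zeroʳ (signℤ c))
... | just t  = signℤ-* c t

score-centreEdges : ∀ {n} c (l : Vec (Maybe Sign) n) is →
  foldr (λ e acc → edgeValue (just c ∷ l) e + acc) 0ℤ (map (λ i → (Fin.zero , Fin.suc i)) is) ≡
  signℤ c * foldr (λ i acc → signValue (lookup l i) + acc) 0ℤ is
score-centreEdges c l []       = sym (*-zeroʳ (signℤ c))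
score-centreEdges c l (i ∷ is) =
  trans (cong₂ _+_ (edgeValue-centre c l i) (score-centreEdges c l is))
        (sym (*-distribˡ-+ (signℤ c) _ _))

score-star : ∀ {n} c (l : Vec (Maybe Sign) n) → score (star n) (just c ∷ l) ≡ signℤ c * signSum l
score-star {n} c l = trans (score-centreEdges c l (allFin n)) (cong (signℤ c *_) (signSum-lookup l))

preferred : Player → Sign
preferred P = Sign.+
preferred N = Sign.-

-- The net effect of u leaves assigned alternately, p first, each player
-- giving the edge to the centre the sign they prefer.
parityBonus : Player → ℕ → ℤ
parityBonus p zero    = 0ℤ
parityBonus p (suc u) = signℤ (preferred p) + parityBonus (other p) u

-- Position with centre x, u unassigned leaves, assigned leaves summing to d,
-- and p to move.  With the centre free, p assigns it at once, choosing the
-- sign that turns d in their favour.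
starOutcome : Player → Maybe Sign → ℕ → ℤ → Outcome
starOutcome p (just c) u d = outcomeOf (signℤ c * d + parityBonus p u)
starOutcome p nothing  u d = outcomeOf (signℤ (preferred p) * + ∣ d ∣ + parityBonus (other p) u)

bestCentre : Player → ℤ → Sign
bestCentre p d = preferred p *ˢ sign d

signℤ≤1 : ∀ s → signℤ s ≤ℤ 1ℤ
signℤ≤1 Sign.+ = ≤-refl
signℤ≤1 Sign.- = -≤+

-1≤signℤ : ∀ s → - 1ℤ ≤ℤ signℤ s
-1≤signℤ Sign.+ = -≤+
-1≤signℤ Sign.- = ≤-refl

preferred-⊑ : ∀ p s → signℤ s ⊑[ p ] signℤ (preferred p)
preferred-⊑ P s = signℤ≤1 s
preferred-⊑ N s = -1≤signℤ s

z⊑preferred*∣z∣ : ∀ p z → z ⊑[ p ] signℤ (preferred p) * + ∣ z ∣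
z⊑preferred*∣z∣ P (+ n)      = ≤-reflexive (sym (*-identityˡ (+ n)))
z⊑preferred*∣z∣ P -[1+ n ]   = -≤+
z⊑preferred*∣z∣ N (+ n)      = ≤-trans (≤-reflexive (-1*i≡-i (+ n))) neg-≤-pos
z⊑preferred*∣z∣ N -[1+ n ]   = ≤-reflexive (-1*i≡-i +[1+ n ])

∣signℤ*z∣≡∣z∣ : ∀ s z → ∣ signℤ s * z ∣ ≡ ∣ z ∣
∣signℤ*z∣≡∣z∣ Sign.+ z = trans (∣i*j∣≡∣i∣*∣j∣ 1ℤ z) (ℕ.*-identityˡ ∣ z ∣)
∣signℤ*z∣≡∣z∣ Sign.- z = trans (∣i*j∣≡∣i∣*∣j∣ (- 1ℤ) z) (ℕ.*-identityˡ ∣ z ∣)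

bestCentre*d≡preferred*∣d∣ : ∀ p d → signℤ (bestCentre p d) * d ≡ signℤ (preferred p) * + ∣ d ∣
bestCentre*d≡preferred*∣d∣ P (+ n)    = refl
bestCentre*d≡preferred*∣d∣ P -[1+ n ] = refl
bestCentre*d≡preferred*∣d∣ N (+ n)    = refl
bestCentre*d≡preferred*∣d∣ N -[1+ n ] = refl

1≤∣d∣+∣s+d∣ : ∀ s d → 1 ≤ ∣ d ∣ ℕ.+ ∣ signℤ s + d ∣
1≤∣d∣+∣s+d∣ Sign.+ (+ 0)    = ℕ.≤-refl
1≤∣d∣+∣s+d∣ Sign.- (+ 0)    = ℕ.≤-refl
1≤∣d∣+∣s+d∣ s      +[1+ n ] = s≤s z≤n
1≤∣d∣+∣s+d∣ s      -[1+ n ] = s≤s z≤n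

freeCentre-leaf-⊑ : ∀ p s d u →
  signℤ (preferred (other p)) * + ∣ signℤ s + d ∣ + parityBonus p u ⊑[ p ]
  signℤ (preferred p) * + ∣ d ∣ + parityBonus (other p) (suc u)
freeCentre-leaf-⊑ P s d u = 0≤i-j⇒j≤i
  (subst (0ℤ ≤ℤ_) (freeLeafP-rearrange (+ ∣ d ∣) (+ ∣ signℤ s + d ∣) (parityBonus P u))
    (i≤j⇒0≤j-i (+≤+ (1≤∣d∣+∣s+d∣ s d))))
  where
  freeLeafP-rearrange : ∀ D A b → D + A - 1ℤ ≡ (1ℤ * D + (- 1ℤ + b)) - (- 1ℤ * A + b)
  freeLeafP-rearrange = solve-∀
freeCentre-leaf-⊑ N s d u = 0≤i-j⇒j≤i
  (subst (0ℤ ≤ℤ_) (freeLeafN-rearrange (+ ∣ d ∣) (+ ∣ signℤ s + d ∣) (parityBonus N u))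
    (i≤j⇒0≤j-i (+≤+ (1≤∣d∣+∣s+d∣ s d))))
  where
  freeLeafN-rearrange : ∀ D A b → D + A - 1ℤ ≡ (1ℤ * A + b) - (- 1ℤ * D + (1ℤ + b))
  freeLeafN-rearrange = solve-∀

starOutcome-just-leaf : ∀ p c u d s →
  starOutcome (other p) (just c) u (signℤ s + d) ≡
  outcomeOf (signℤ (c *ˢ s) + (signℤ c * d + parityBonus (other p) u))
starOutcome-just-leaf p c u d s = cong outcomeOf (begin
  signℤ c * (signℤ s + d) + b          ≡⟨ leafMove-rearrange (signℤ c) (signℤ s) d b ⟩
  signℤ c * signℤ s + (signℤ c * d + b) ≡⟨ cong (_+ (signℤ c * d + b)) (sym (signℤ-* c s)) ⟩
  signℤ (c *ˢ s) + (signℤ c * d + b)    ∎)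
  where
  b : ℤ
  b = parityBonus (other p) u
  leafMove-rearrange : ∀ c s d b → c * (s + d) + b ≡ c * s + (c * d + b)
  leafMove-rearrange = solve-∀

starOutcome-just-suc : ∀ p c u d →
  starOutcome p (just c) (suc u) d ≡
  outcomeOf (signℤ (preferred p) + (signℤ c * d + parityBonus (other p) u))
starOutcome-just-suc p c u d =
  cong outcomeOf (x∙yz≈y∙xz (signℤ c * d) (signℤ (preferred p)) (parityBonus (other p) u))

starOutcome-leaf-≼ : ∀ p x u d s →
  starOutcome (other p) x u (signℤ s + d) ≼[ p ] starOutcome p x (suc u) d
starOutcome-leaf-≼ p (just c) u d s
  rewrite starOutcome-just-leaf p c u d s | starOutcome-just-suc p c u d =
  outcomeOf-mono p (⊑-+ʳ p _ (preferred-⊑ p (c *ˢ s)))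
starOutcome-leaf-≼ P nothing u d s = outcomeOf-mono P (freeCentre-leaf-⊑ P s d u)
starOutcome-leaf-≼ N nothing u d s = outcomeOf-mono N (freeCentre-leaf-⊑ N s d u)

starOutcome-leaf-≡ : ∀ p c u d →
  starOutcome (other p) (just c) u (signℤ (c *ˢ preferred p) + d) ≡ starOutcome p (just c) (suc u) d
starOutcome-leaf-≡ p c u d = begin
  starOutcome (other p) (just c) u (signℤ (c *ˢ preferred p) + d)
    ≡⟨ starOutcome-just-leaf p c u d (c *ˢ preferred p) ⟩
  outcomeOf (signℤ (c *ˢ (c *ˢ preferred p)) + z)
    ≡⟨ cong (λ t → outcomeOf (signℤ t + z)) c*c*σ≡σ ⟩
  outcomeOf (signℤ (preferred p) + z)
    ≡⟨ sym (starOutcome-just-suc p c u d) ⟩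
  starOutcome p (just c) (suc u) d ∎
  where
  z : ℤ
  z = signℤ c * d + parityBonus (other p) u
  c*c*σ≡σ : c *ˢ (c *ˢ preferred p) ≡ preferred p
  c*c*σ≡σ = trans (sym (Sign.*-assoc c c (preferred p))) (cong (_*ˢ preferred p) (Sign.s*s≡+ c))

starOutcome-centre-≼ : ∀ p s u d → starOutcome (other p) (just s) u d ≼[ p ] starOutcome p nothing u d
starOutcome-centre-≼ p s u d = outcomeOf-mono p (⊑-+ʳ p (parityBonus (other p) u)
  (subst (λ m → signℤ s * d ⊑[ p ] signℤ (preferred p) * + m) (∣signℤ*z∣≡∣z∣ s d)
    (z⊑preferred*∣z∣ p (signℤ s * d))))

starOutcome-centre-≡ : ∀ p u d →
  starOutcome (other p) (just (bestCentre p d)) u d ≡ starOutcome p nothing u d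
starOutcome-centre-≡ p u d =
  cong (λ z → outcomeOf (z + parityBonus (other p) u)) (bestCentre*d≡preferred*∣d∣ p d)

ClosedForm : ℕ → ℕ → Set
ClosedForm n k = ∀ p x (l : Vec (Maybe Sign) n) → unassigned (x ∷ l) ≡ k →
  value (star n) k p (x ∷ l) ≡ starOutcome p x (unassigned l) (signSum l)

value-star-zero : ∀ {n} → ClosedForm n 0
value-star-zero {n} p (just c) l none-free = begin
  value (star n) 0 p (just c ∷ l)
    ≡⟨ value-zero (star n) p (just c ∷ l) ⟩
  outcomeOf (score (star n) (just c ∷ l))
    ≡⟨ cong outcomeOf (score-star c l) ⟩
  outcomeOf (signℤ c * signSum l)
    ≡⟨ cong outcomeOf (sym (+-identityʳ (signℤ c * signSum l))) ⟩
  starOutcome p (just c) 0 (signSum l)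
    ≡⟨ cong (λ u → starOutcome p (just c) u (signSum l)) (sym none-free) ⟩
  starOutcome p (just c) (unassigned l) (signSum l) ∎

module _ {n k : ℕ} (ih : ClosedForm n k) where

  centreMove-value : ∀ p s (l : Vec (Maybe Sign) n) → unassigned (nothing ∷ l) ≡ suc k →
    value (star n) k (other p) (just s ∷ l) ≡ starOutcome (other p) (just s) (unassigned l) (signSum l)
  centreMove-value p s l fuel = ih (other p) (just s) l (ℕ.suc-injective fuel)

  leafMove-value : ∀ p x (l : Vec (Maybe Sign) n) {j} s →
    lookup l j ≡ nothing → unassigned (x ∷ l) ≡ suc k →
    value (star n) k (other p) (x ∷ l [ j ]≔ just s) ≡
    starOutcome (other p) x (unassigned (l [ j ]≔ just s)) (signℤ s + signSum l)
  leafMove-value p x l {j} s free fuel =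
    trans (ih (other p) x (l [ j ]≔ just s)
            (ℕ.suc-injective (trans (sym (unassigned-[]≔ (x ∷ l) {Fin.suc j} s free)) fuel)))
          (cong (starOutcome (other p) x (unassigned (l [ j ]≔ just s))) (signSum-[]≔ l s free))

  optimalMove : ∀ p x (l : Vec (Maybe Sign) n) → unassigned (x ∷ l) ≡ suc k →
    ∃₂ λ i s → lookup (x ∷ l) i ≡ nothing ×
      value (star n) k (other p) ((x ∷ l) [ i ]≔ just s) ≡ starOutcome p x (unassigned l) (signSum l)
  optimalMove p nothing l fuel =
    Fin.zero , bestCentre p (signSum l) , refl ,
    trans (centreMove-value p _ l fuel) (starOutcome-centre-≡ p (unassigned l) (signSum l))
  optimalMove p (just c) l fuel with unassigned⇒free l fuel
  ... | j , free =
    Fin.suc j , σ , free ,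
    trans (leafMove-value p (just c) l σ free fuel)
      (trans (starOutcome-leaf-≡ p c (unassigned (l [ j ]≔ just σ)) (signSum l))
        (cong (λ u → starOutcome p (just c) u (signSum l)) (sym (unassigned-[]≔ l σ free))))
    where
    σ : Sign
    σ = c *ˢ preferred p

  noBetterMove : ∀ p x (l : Vec (Maybe Sign) n) → unassigned (x ∷ l) ≡ suc k → ∀ i s →
    lookup (x ∷ l) i ≡ nothing →
    value (star n) k (other p) ((x ∷ l) [ i ]≔ just s) ≼[ p ] starOutcome p x (unassigned l) (signSum l)
  noBetterMove p x l fuel Fin.zero s refl =
    subst (_≼[ p ] _) (sym (centreMove-value p s l fuel)) (starOutcome-centre-≼ p s (unassigned l) (signSum l))
  noBetterMove p x l fuel (Fin.suc j) s free =
    subst₂ (_≼[ p ]_) (sym (leafMove-value p x l s free fuel))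
      (cong (λ u → starOutcome p x u (signSum l)) (sym (unassigned-[]≔ l s free)))
      (starOutcome-leaf-≼ p x (unassigned (l [ j ]≔ just s)) (signSum l) s)

  value-star-suc : ClosedForm n (suc k)
  value-star-suc p x l fuel =
    value-suc (star n) k p (x ∷ l) (optimalMove p x l fuel) (noBetterMove p x l fuel)

value-star : ∀ {n} k → ClosedForm n k
value-star zero    = value-star-zero
value-star (suc k) = value-star-suc (value-star k)

result-star : ∀ n first → result (star n) first ≡ outcomeOf (parityBonus (other first) n)
result-star n first = begin
  value (star n) (suc n) first (nothing ∷ empty)
    ≡⟨ value-star (suc n) first nothing empty (cong suc (unassigned-replicate n)) ⟩
  starOutcome first nothing (unassigned empty) (signSum empty)
    ≡⟨ cong₂ (starOutcome first nothing) (unassigned-replicate n) (signSum-replicate n) ⟩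
  outcomeOf (signℤ (preferred first) * 0ℤ + b)
    ≡⟨ cong outcomeOf (trans (cong (_+ b) (*-zeroʳ (signℤ (preferred first)))) (+-identityˡ b)) ⟩
  outcomeOf b ∎
  where
  empty : Vec (Maybe Sign) n
  empty = replicate n nothing
  b : ℤ
  b = parityBonus (other first) n

x+[-x+y]≡y : ∀ x y → x + (- x + y) ≡ y
x+[-x+y]≡y = solve-∀

parityBonus-2+ : ∀ p u → parityBonus p (2 ℕ.+ u) ≡ parityBonus p u
parityBonus-2+ P u = x+[-x+y]≡y 1ℤ (parityBonus P u)
parityBonus-2+ N u = x+[-x+y]≡y (- 1ℤ) (parityBonus N u)

parityBonus-even : ∀ p u → 2 ∣ u → parityBonus p u ≡ 0ℤ
parityBonus-even p 0             _   = refl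
parityBonus-even p 1             2∣1 = contradiction (∣⇒≤ 2∣1) λ { (s≤s ()) }
parityBonus-even p (suc (suc u)) 2∣u =
  trans (parityBonus-2+ p u) (parityBonus-even p u (∣m+n∣m⇒∣n 2∣u ∣-refl))

parityBonus-odd : ∀ p u → ¬ 2 ∣ u → parityBonus p u ≡ signℤ (preferred p)
parityBonus-odd p 0             2∤0 = contradiction (2 ∣0) 2∤0
parityBonus-odd p 1             _   = +-identityʳ _
parityBonus-odd p (suc (suc u)) 2∤u =
  trans (parityBonus-2+ p u) (parityBonus-odd p u (2∤u ∘ ∣m∣n⇒∣m+n ∣-refl))

outcomeOf-preferred : ∀ p → outcomeOf (signℤ (preferred p)) ≡ winFor p
outcomeOf-preferred P = refl
outcomeOf-preferred N = refl

theorem2 : (n : ℕ) → 1 ≤ n → (first : Player) →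
    (2 ∣ n → result (star n) first ≡ Draw) ×
    (¬ (2 ∣ n) → result (star n) first ≡ winFor (other first))
theorem2 n _ first =
  (λ 2∣n → trans (result-star n first) (cong outcomeOf (parityBonus-even (other first) n 2∣n))) ,
  (λ 2∤n → trans (result-star n first)
             (trans (cong outcomeOf (parityBonus-odd (other first) n 2∤n)) (outcomeOf-preferred (other first))))
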